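{- Let $\phi=\frac{1+\sqrt{5}}{2}$ and let $(F_i)_{i\geqslant 1}$ be the Fibonacci numbers with $F_1=F_2=1$, $F_{i+2}=F_{i+1}+F_i$. Let $S=\{F_{2n+1}-1 : n\geqslant 1\}=\{1,4,12,\ldots\}$, and consider the subtraction game on nonnegative integers with subtraction set $S$. Let $g$ be its Sprague–Grundy function. Define $B=\{\lfloor n\phi^2 \rfloor : n\geqslant 1\}$, $B+1=\{\lfloor n\phi^2 \rfloor +1 : n\geqslant 0\}$, and $AB+1=\{2\lfloor n\phi \rfloor + n+1 : n\geqslant 1\}$. Then $g(x)=0$ if $x\in B$, $g(x)=1$ if $x\in B+1$, and $g(x)=2$ if $x\in AB+1$.
   Context: The subtraction game with subtraction set $S$ is the two-player impartial game in which a position is a nonnegative integer $x$; the players alternate moving, and a move from $x$ goes to $x-s$ for some $s\in S$ with $x-s\geqslant 0$. A player unable to move loses. The Sprague–Grundy function $g$ is defined recursively: $g(x)$ is the least nonnegative integer not in $\{g(x-s): s\in S,\ x-s\geqslant 0\}$ (so in particular $g(0)=0$, as $0$ is terminal). $\lfloor\cdot\rfloor$ denotes the floor function. -}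

module Defs where

open import Data.Nat using (ℕ; zero; suc; _+_; _*_; _∸_; _≤_; _<_)
open import Data.Product using (Σ; _×_; ∃)
open import Relation.Binary.PropositionalEquality using (_≡_)
open import Relation.Nullary using (¬_)

fib : ℕ → ℕ
fib zero = 0
fib (suc zero) = 1
fib (suc (suc n)) = fib (suc n) + fib n

InS : ℕ → Set
InS s = Σ ℕ λ n → 1 ≤ n × s ≡ fib (2 * n + 1) ∸ 1

IsMex : ℕ → (ℕ → Set) → Set
IsMex k P = ¬ P k × (∀ j → j < k → P j)

IsSGFunction : (ℕ → Set) → (ℕ → ℕ) → Set
IsSGFunction S g = ∀ x → IsMex (g x) (λ v → Σ ℕ λ s → S s × s ≤ x × g (x ∸ s) ≡ v)

-- FloorHalfSqrt5 a b m  :⇔  m = ⌊ (a + b√5) / 2 ⌋, i.e.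
--   m ≤ (a + b√5)/2 < m + 1, written out in integer arithmetic:
--   2m - a ≤ b√5        ⇔  (2m ∸ a)² ≤ 5b²
--   b√5 < 2(m+1) - a    ⇔  a < 2(m+1)  and  5b² < (2(m+1) ∸ a)²
FloorHalfSqrt5 : ℕ → ℕ → ℕ → Set
FloorHalfSqrt5 a b m =
  ((2 * m ∸ a) * (2 * m ∸ a) ≤ 5 * (b * b)) ×
  (a < 2 * (m + 1)) ×
  (5 * (b * b) < (2 * (m + 1) ∸ a) * (2 * (m + 1) ∸ a))

-- m = ⌊ n φ ⌋   (n φ = (n + n√5)/2)
FloorNPhi : ℕ → ℕ → Set
FloorNPhi n m = FloorHalfSqrt5 n n m

-- m = ⌊ n φ² ⌋  (n φ² = (3n + n√5)/2)
FloorNPhi2 : ℕ → ℕ → Set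
FloorNPhi2 n m = FloorHalfSqrt5 (3 * n) n m

InB : ℕ → Set
InB x = Σ ℕ λ n → 1 ≤ n × Σ ℕ λ m → FloorNPhi2 n m × x ≡ m

InB+1 : ℕ → Set
InB+1 x = Σ ℕ λ n → Σ ℕ λ m → FloorNPhi2 n m × x ≡ m + 1

InAB+1 : ℕ → Set
InAB+1 x = Σ ℕ λ n → 1 ≤ n × Σ ℕ λ m → FloorNPhi n m × x ≡ 2 * m + n + 1

module Submission where

open import Defs
open import Data.Nat using (ℕ)
open import Data.Product using (_×_)
open import Relation.Binary.PropositionalEquality using (_≡_)
import Data.Nat as N
open N using (zero; suc)
import Data.Nat.Properties as NP
open import Data.Nat.Induction using (<-rec)
import Data.Nat.Tactic.RingSolver as NS
open import Data.Integer using (ℤ; +_; -[1+_]; +[1+_]; _+_; _*_; -_; _-_)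
import Data.Integer.Properties as ZP
open import Data.Integer.Tactic.RingSolver using (solve-∀)
open import Data.Product using (Σ; _,_; proj₁; proj₂)
open import Data.Sum using (_⊎_; inj₁; inj₂)
import Data.Sum as Sum
open import Data.Unit using (⊤; tt)
open import Data.Empty using (⊥; ⊥-elim)
open import Relation.Nullary using (¬_; yes; no)
open import Relation.Binary using (tri<; tri≈; tri>)
open import Relation.Binary.PropositionalEquality
  using (_≢_; refl; sym; trans; cong; cong₂; subst; module ≡-Reasoning)

-- Every x ≥ 0 is ⌊nφ²⌋ + c for the n with ⌊nφ²⌋ ≤ x < ⌊(n+1)φ²⌋.  Since
-- consecutive values of ⌊nφ²⌋ differ by 2 or 3, c ≤ 2, and c = 2 only in
-- front of a gap of 3.  We prove g(x) = c by strong induction on x: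
--  (i)  no element of S is a difference of two values ⌊nφ²⌋, so no move
--       keeps the shift c;
--  (ii) the move s = 1 lowers c by one, and in front of a gap of 3 some
--       s ∈ S leads from ⌊nφ²⌋ + 2 to a value ⌊kφ²⌋.
-- Both facts come from the approximation of φ by F_{2i+2}/F_{2i+1}, via
-- Cassini's identity and the best approximation property.
--
-- There are no reals: φ is handled exactly in ℤ[φ] = ℤ², ordered by
-- positivity of the coordinates of φⁿx (trichotomy by a Euclidean descent).

-- The pair (p , q) stands for p + qφ ∈ ℤ[φ], where φ² = φ + 1.
Zφ : Set
Zφ = ℤ × ℤ

0φ : Zφ
0φ = + 0 , + 0

_⊕_ : Zφ → Zφ → Zφ
(p , q) ⊕ (r , s) = p + r , q + s

neg : Zφ → Zφ
neg (p , q) = - p , - q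

-- Multiplication in ℤ[φ]: (p + qφ)(r + sφ) = (pr + qs) + (ps + qr + qs)φ.
_⊗_ : Zφ → Zφ → Zφ
(p , q) ⊗ (r , s) = p * r + q * s , p * s + q * r + q * s

timesφ : Zφ → Zφ
timesφ (p , q) = q , p + q

timesφ^ : ℕ → Zφ → Zφ
timesφ^ zero x = x
timesφ^ (suc n) x = timesφ (timesφ^ n x)

PosZ : ℤ → Set
PosZ +[1+ _ ] = ⊤
PosZ (+ zero) = ⊥
PosZ -[1+ _ ] = ⊥

BothPos : Zφ → Set
BothPos (p , q) = PosZ p × PosZ q

-- The order of ℤ[φ] ⊂ ℝ without reals: x > 0 iff the coordinates of φⁿx,
-- which grow like x·φⁿ, are both positive for some n.
Pos : Zφ → Set
Pos x = Σ ℕ λ n → BothPos (timesφ^ n x)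

NonNeg : Zφ → Set
NonNeg x = Pos x ⊎ x ≡ 0φ

Pos-≡ : ∀ {p q p′ q′} → p ≡ p′ → q ≡ q′ → Pos (p , q) → Pos (p′ , q′)
Pos-≡ refl refl x = x

NonNeg-≡ : ∀ {p q p′ q′} → p ≡ p′ → q ≡ q′ → NonNeg (p , q) → NonNeg (p′ , q′)
NonNeg-≡ refl refl x = x

PosZ-+ : ∀ p q → PosZ p → PosZ q → PosZ (p + q)
PosZ-+ +[1+ _ ] +[1+ _ ] _ _ = tt

PosZ-* : ∀ p q → PosZ p → PosZ q → PosZ (p * q)
PosZ-* +[1+ _ ] +[1+ _ ] _ _ = tt

PosZ-neg : ∀ p → PosZ p → PosZ (- p) → ⊥
PosZ-neg +[1+ _ ] _ ()

BothPos-timesφ^ : ∀ k x → BothPos x → BothPos (timesφ^ k x)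
BothPos-timesφ^ zero x bp = bp
BothPos-timesφ^ (suc k) x bp with timesφ^ k x | BothPos-timesφ^ k x bp
... | p , q | bp′ , bq′ = bq′ , PosZ-+ p q bp′ bq′

BothPos-⊕ : ∀ x y → BothPos x → BothPos y → BothPos (x ⊕ y)
BothPos-⊕ (p , q) (r , s) (bp , bq) (br , bs) = PosZ-+ p r bp br , PosZ-+ q s bq bs

BothPos-⊗ : ∀ x y → BothPos x → BothPos y → BothPos (x ⊗ y)
BothPos-⊗ (p , q) (r , s) (bp , bq) (br , bs) =
  PosZ-+ (p * r) (q * s) (PosZ-* p r bp br) (PosZ-* q s bq bs) ,
  PosZ-+ (p * s + q * r) (q * s)
    (PosZ-+ (p * s) (q * r) (PosZ-* p s bp bs) (PosZ-* q r bq br)) (PosZ-* q s bq bs)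

timesφ-⊕ : ∀ x y → timesφ (x ⊕ y) ≡ timesφ x ⊕ timesφ y
timesφ-⊕ (p , q) (r , s) = cong (q + s ,_) (ring p q r s)
  where
  ring : ∀ p q r s → p + r + (q + s) ≡ p + q + (r + s)
  ring = solve-∀

timesφ-neg : ∀ x → timesφ (neg x) ≡ neg (timesφ x)
timesφ-neg (p , q) = cong (- q ,_) (sym (ZP.neg-distrib-+ p q))

timesφ-⊗ˡ : ∀ x y → timesφ (x ⊗ y) ≡ timesφ x ⊗ y
timesφ-⊗ˡ (p , q) (r , s) = cong₂ _,_ (ring₁ p q r s) (ring₂ p q r s)
  where
  ring₁ : ∀ p q r s → p * s + q * r + q * s ≡ q * r + (p + q) * s
  ring₁ = solve-∀
  ring₂ : ∀ p q r s → p * r + q * s + (p * s + q * r + q * s) ≡ q * s + (p + q) * r + (p + q) * s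
  ring₂ = solve-∀

timesφ^-+ : ∀ k n x → timesφ^ (k N.+ n) x ≡ timesφ^ k (timesφ^ n x)
timesφ^-+ zero n x = refl
timesφ^-+ (suc k) n x = cong timesφ (timesφ^-+ k n x)

timesφ^-⊕ : ∀ n x y → timesφ^ n (x ⊕ y) ≡ timesφ^ n x ⊕ timesφ^ n y
timesφ^-⊕ zero x y = refl
timesφ^-⊕ (suc n) x y = trans (cong timesφ (timesφ^-⊕ n x y)) (timesφ-⊕ (timesφ^ n x) (timesφ^ n y))

timesφ^-neg : ∀ n x → timesφ^ n (neg x) ≡ neg (timesφ^ n x)
timesφ^-neg zero x = refl
timesφ^-neg (suc n) x = trans (cong timesφ (timesφ^-neg n x)) (timesφ-neg (timesφ^ n x))

timesφ^-⊗ˡ : ∀ n x y → timesφ^ n (x ⊗ y) ≡ timesφ^ n x ⊗ y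
timesφ^-⊗ˡ zero x y = refl
timesφ^-⊗ˡ (suc n) x y = trans (cong timesφ (timesφ^-⊗ˡ n x y)) (timesφ-⊗ˡ (timesφ^ n x) y)

⊗-comm : ∀ x y → x ⊗ y ≡ y ⊗ x
⊗-comm (p , q) (r , s) = cong₂ _,_ (ring₁ p q r s) (ring₂ p q r s)
  where
  ring₁ : ∀ p q r s → p * r + q * s ≡ r * p + s * q
  ring₁ = solve-∀
  ring₂ : ∀ p q r s → p * s + q * r + q * s ≡ r * q + s * p + s * q
  ring₂ = solve-∀

timesφ^-⊗ʳ : ∀ n x y → timesφ^ n (x ⊗ y) ≡ x ⊗ timesφ^ n y
timesφ^-⊗ʳ n x y = trans (cong (timesφ^ n) (⊗-comm x y))
  (trans (timesφ^-⊗ˡ n y x) (⊗-comm (timesφ^ n y) x))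

Pos-common : ∀ x y → Pos x → Pos y → Σ ℕ λ m → BothPos (timesφ^ m x) × BothPos (timesφ^ m y)
Pos-common x y (n , bx) (k , by) = k N.+ n , later-x , later-y
  where
  later-x : BothPos (timesφ^ (k N.+ n) x)
  later-x = subst BothPos (sym (timesφ^-+ k n x)) (BothPos-timesφ^ k _ bx)
  later-y : BothPos (timesφ^ (k N.+ n) y)
  later-y = subst BothPos (trans (sym (timesφ^-+ n k y)) (cong (λ m → timesφ^ m y) (NP.+-comm n k)))
    (BothPos-timesφ^ n _ by)

Pos-⊕ : ∀ x y → Pos x → Pos y → Pos (x ⊕ y)
Pos-⊕ x y px py with Pos-common x y px py
... | m , bx , by = m , subst BothPos (sym (timesφ^-⊕ m x y)) (BothPos-⊕ _ _ bx by)

Pos-⊗ : ∀ x y → Pos x → Pos y → Pos (x ⊗ y)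
Pos-⊗ x y (n , bx) (k , by) = n N.+ k , subst BothPos (sym shift) (BothPos-⊗ _ _ bx by)
  where
  shift : timesφ^ (n N.+ k) (x ⊗ y) ≡ timesφ^ n x ⊗ timesφ^ k y
  shift = trans (timesφ^-+ n k (x ⊗ y))
    (trans (cong (timesφ^ n) (timesφ^-⊗ʳ k x y)) (timesφ^-⊗ˡ n x (timesφ^ k y)))

Pos-asym : ∀ x → Pos x → Pos (neg x) → ⊥
Pos-asym x px pnx with Pos-common x (neg x) px pnx
... | m , bx , bnx = PosZ-neg _ (proj₁ bx) (proj₁ (subst BothPos (timesφ^-neg m x) bnx))

Pos-0φ : Pos 0φ → ⊥
Pos-0φ (n , b) = proj₁ (subst BothPos (timesφ^-0φ n) b)
  where
  timesφ^-0φ : ∀ n → timesφ^ n 0φ ≡ 0φ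
  timesφ^-0φ zero = refl
  timesφ^-0φ (suc n) = cong timesφ (timesφ^-0φ n)

Pos-timesφ⁻ : ∀ x → Pos (timesφ x) → Pos x
Pos-timesφ⁻ x (n , b) = suc n , subst BothPos (timesφ^-timesφ n x) b
  where
  timesφ^-timesφ : ∀ n x → timesφ^ n (timesφ x) ≡ timesφ (timesφ^ n x)
  timesφ^-timesφ zero x = refl
  timesφ^-timesφ (suc n) x = cong timesφ (timesφ^-timesφ n x)

Trichotomy : Zφ → Set
Trichotomy x = Pos x ⊎ x ≡ 0φ ⊎ Pos (neg x)

neg-involutive : ∀ x → neg (neg x) ≡ x
neg-involutive (p , q) = cong₂ _,_ (ZP.neg-involutive p) (ZP.neg-involutive q)

Trichotomy-neg⁻ : ∀ x → Trichotomy (neg x) → Trichotomy x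
Trichotomy-neg⁻ x (inj₁ p) = inj₂ (inj₂ p)
Trichotomy-neg⁻ x (inj₂ (inj₁ e)) = inj₂ (inj₁ (trans (sym (neg-involutive x)) (cong neg e)))
Trichotomy-neg⁻ x (inj₂ (inj₂ p)) = inj₁ (subst Pos (neg-involutive x) p)

Trichotomy-timesφ⁻ : ∀ x → Trichotomy (timesφ x) → Trichotomy x
Trichotomy-timesφ⁻ x (inj₁ p) = inj₁ (Pos-timesφ⁻ x p)
Trichotomy-timesφ⁻ (p , q) (inj₂ (inj₁ e)) = inj₂ (inj₁ (cong₂ _,_ p≡0 q≡0))
  where
  q≡0 : q ≡ + 0
  q≡0 = cong proj₁ e
  p≡0 : p ≡ + 0
  p≡0 = trans (sym (ZP.+-identityʳ p)) (trans (cong (λ z → p + z) (sym q≡0)) (cong proj₂ e))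
Trichotomy-timesφ⁻ (p , q) (inj₂ (inj₂ n)) = inj₂ (inj₂ (Pos-timesφ⁻ (neg (p , q))
  (Pos-≡ refl (ZP.neg-distrib-+ p q) n)))

-- Trichotomy for a - bφ (a, b ∈ ℕ) by a Euclid-like descent: for a ≥ b,
-- -(a - bφ)φ = b - (a - b)φ has smaller coefficient sum; for a < b the
-- element -(a - bφ)φ = b + (b - a)φ is coordinatewise positive.  The fuel f
-- bounds a + b.
Trichotomy-mixed : ∀ f a b → a N.+ b N.≤ f → Trichotomy (+ a , - (+ b))
Trichotomy-descend : ∀ f a b k → a ≡ b N.+ k → a N.+ suc b N.≤ f →
                     Trichotomy (+ suc a , - (+ suc b))

Trichotomy-mixed f zero zero _ = inj₂ (inj₁ refl)
Trichotomy-mixed f (suc a) zero _ = inj₁ (2 , tt , tt)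
Trichotomy-mixed f zero (suc b) _ = inj₂ (inj₂ (1 , tt , tt))
Trichotomy-mixed zero (suc a) (suc b) ()
Trichotomy-mixed (suc f) (suc a) (suc b) (N.s≤s bound) with N.compare a b
... | N.less a k = Trichotomy-timesφ⁻ _ (inj₂ (inj₂ (0 , tt , subst PosZ (sym difference) tt)))
  where
  ring : ∀ a k → - (+ 1 + a + - (+ 2 + (a + k))) ≡ + 1 + k
  ring = solve-∀
  difference : - (+ suc a + - (+ suc (suc (a N.+ k)))) ≡ + suc k
  difference = trans (cong (λ c → - (+ suc a + - c)) (ZP.pos-+ 2 (a N.+ k)))
    (trans (cong (λ c → - (+ suc a + - (+ 2 + c))) (ZP.pos-+ a k)) (ring (+ a) (+ k)))
... | N.equal a = Trichotomy-descend f a a 0 (sym (NP.+-identityʳ a)) bound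
... | N.greater b k = Trichotomy-descend f (suc (b N.+ k)) b (suc k) (sym (NP.+-suc b k)) bound

Trichotomy-descend f _ b k refl bound = Trichotomy-timesφ⁻ _ (Trichotomy-neg⁻ _
  (subst Trichotomy (cong₂ _,_ refl (cong -_ (sym difference)))
    (Trichotomy-mixed f (suc b) k smaller)))
  where
  ring : ∀ b k → + 1 + (b + k) + - (+ 1 + b) ≡ k
  ring = solve-∀
  difference : + suc (b N.+ k) + - (+ suc b) ≡ + k
  difference = trans (cong₂ (λ u v → u + - v) (cong (λ c → + 1 + c) (ZP.pos-+ b k)) (ZP.pos-+ 1 b))
    (ring (+ b) (+ k))
  smaller : suc b N.+ k N.≤ f
  smaller = NP.≤-trans (NP.≤-reflexive (trans (cong suc (NP.+-comm b k)) (sym (NP.+-suc k b))))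
    (NP.≤-trans (NP.+-monoˡ-≤ (suc b) (NP.m≤n+m k b)) bound)

trichotomy : ∀ x → Trichotomy x
trichotomy (+ a , + zero) = Trichotomy-mixed _ a 0 NP.≤-refl
trichotomy (+ a , -[1+ b ]) = Trichotomy-mixed _ a (suc b) NP.≤-refl
trichotomy (+ zero , +[1+ b ]) = inj₁ (1 , tt , tt)
trichotomy (+[1+ a ] , +[1+ b ]) = inj₁ (0 , tt , tt)
trichotomy (-[1+ a ] , + b) = Trichotomy-neg⁻ _ (Trichotomy-mixed _ (suc a) b NP.≤-refl)
trichotomy (-[1+ a ] , -[1+ b ]) = inj₂ (inj₂ (0 , tt , tt))

Pos-ℤ : ∀ k → PosZ k → Pos (k , + 0)
Pos-ℤ +[1+ _ ] _ = 2 , tt , tt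

Pos-ℤ⁻ : ∀ k → Pos (k , + 0) → PosZ k
Pos-ℤ⁻ +[1+ _ ] _ = tt
Pos-ℤ⁻ (+ zero) p = ⊥-elim (Pos-0φ p)
Pos-ℤ⁻ -[1+ n ] p = ⊥-elim (Pos-asym (-[1+ n ] , + 0) p (2 , tt , tt))

NonNeg-ℕ : ∀ k → NonNeg (+ k , + 0)
NonNeg-ℕ zero = inj₂ refl
NonNeg-ℕ (suc k) = inj₁ (Pos-ℤ (+ suc k) tt)

NonNeg-ℕ-diagonal : ∀ e → NonNeg (+ e , + e)
NonNeg-ℕ-diagonal zero = inj₂ refl
NonNeg-ℕ-diagonal (suc e) = inj₁ (0 , tt , tt)

_⊙_ : ℤ → Zφ → Zφ
k ⊙ (p , q) = k * p , k * q

Pos-⊙ : ∀ k x → Pos x → Pos ((+ suc k) ⊙ x)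
Pos-⊙ k (p , q) px = Pos-≡ (ring p q) (ring′ p q) (Pos-⊗ _ _ (Pos-ℤ (+ suc k) tt) px)
  where
  ring : ∀ p q → + suc k * p + + 0 * q ≡ + suc k * p
  ring = solve-∀
  ring′ : ∀ p q → + suc k * q + + 0 * p + + 0 * q ≡ + suc k * q
  ring′ = solve-∀

NonNeg-⊙ : ∀ k x → NonNeg x → NonNeg ((+ k) ⊙ x)
NonNeg-⊙ zero (p , q) _ = inj₂ (cong₂ _,_ (ZP.*-zeroˡ p) (ZP.*-zeroˡ q))
NonNeg-⊙ (suc k) x (inj₁ px) = inj₁ (Pos-⊙ k x px)
NonNeg-⊙ (suc k) _ (inj₂ refl) = inj₂ (cong₂ _,_ (ZP.*-zeroʳ (+ suc k)) (ZP.*-zeroʳ (+ suc k)))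

Pos-⊕-NonNeg : ∀ x y → Pos x → NonNeg y → Pos (x ⊕ y)
Pos-⊕-NonNeg x y px (inj₁ py) = Pos-⊕ x y px py
Pos-⊕-NonNeg (p , q) _ px (inj₂ refl) = Pos-≡ (sym (ZP.+-identityʳ p)) (sym (ZP.+-identityʳ q)) px

NonNeg-⊕-Pos : ∀ x y → NonNeg x → Pos y → Pos (x ⊕ y)
NonNeg-⊕-Pos x y (inj₁ px) py = Pos-⊕ x y px py
NonNeg-⊕-Pos _ (r , s) (inj₂ refl) py = Pos-≡ (sym (ZP.+-identityˡ r)) (sym (ZP.+-identityˡ s)) py

NonNeg-⊕ : ∀ x y → NonNeg x → NonNeg y → NonNeg (x ⊕ y)
NonNeg-⊕ x y (inj₁ px) ny = inj₁ (Pos-⊕-NonNeg x y px ny)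
NonNeg-⊕ _ (r , s) (inj₂ refl) ny = NonNeg-≡ (sym (ZP.+-identityˡ r)) (sym (ZP.+-identityˡ s)) ny

NonNeg-asym : ∀ x → NonNeg x → Pos (neg x) → ⊥
NonNeg-asym x (inj₁ px) pnx = Pos-asym x px pnx
NonNeg-asym _ (inj₂ refl) pnx = Pos-0φ pnx

Pos-sum : ∀ {p q r s p′ q′} → Pos (p , q) → Pos (r , s) →
          p + r ≡ p′ → q + s ≡ q′ → Pos (p′ , q′)
Pos-sum px py e₁ e₂ = Pos-≡ e₁ e₂ (Pos-⊕ _ _ px py)

Pos-sum-nonneg : ∀ {p q r s p′ q′} → Pos (p , q) → NonNeg (r , s) →
           p + r ≡ p′ → q + s ≡ q′ → Pos (p′ , q′)
Pos-sum-nonneg px ny e₁ e₂ = Pos-≡ e₁ e₂ (Pos-⊕-NonNeg _ _ px ny)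

NonNeg-sum : ∀ {p q r s p′ q′} → NonNeg (p , q) → NonNeg (r , s) →
             p + r ≡ p′ → q + s ≡ q′ → NonNeg (p′ , q′)
NonNeg-sum nx ny e₁ e₂ = NonNeg-≡ e₁ e₂ (NonNeg-⊕ _ _ nx ny)

double-neg : ∀ x → neg x ⊕ neg x ≡ neg (x ⊕ x)
double-neg (p , q) = cong₂ _,_ (sym (ZP.neg-distrib-+ p p)) (sym (ZP.neg-distrib-+ q q))

Pos-half : ∀ x → Pos (x ⊕ x) → Pos x
Pos-half x p2x with trichotomy x
... | inj₁ px = px
... | inj₂ (inj₁ refl) = ⊥-elim (Pos-0φ p2x)
... | inj₂ (inj₂ pnx) = ⊥-elim (Pos-asym _ p2x (subst Pos (double-neg x) (Pos-⊕ _ _ pnx pnx)))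

NonNeg-half : ∀ x → NonNeg (x ⊕ x) → NonNeg x
NonNeg-half x n2x with trichotomy x
... | inj₁ px = inj₁ px
... | inj₂ (inj₁ x≡0) = inj₂ x≡0
... | inj₂ (inj₂ pnx) = ⊥-elim (NonNeg-asym _ n2x (subst Pos (double-neg x) (Pos-⊕ _ _ pnx pnx)))

-- 1 < φ < 2.
Pos-φ-1 : Pos (-[1+ 0 ] , + 1)
Pos-φ-1 = 3 , tt , tt

Pos-2-φ : Pos (+ 2 , -[1+ 0 ])
Pos-2-φ = 4 , tt , tt

NonNeg-or-neg : ∀ x → NonNeg x ⊎ Pos (neg x)
NonNeg-or-neg x with trichotomy x
... | inj₁ px = inj₁ (inj₁ px)
... | inj₂ (inj₁ x≡0) = inj₁ (inj₂ x≡0)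
... | inj₂ (inj₂ pnx) = inj₂ pnx

NonNeg-contradiction : ∀ {p q r s} → NonNeg (p , q) → Pos (r , s) → r ≡ - p → s ≡ - q → ⊥
NonNeg-contradiction nn pos refl refl = NonNeg-asym _ nn pos

NonNeg-⊗-Pos : ∀ x y → NonNeg x → Pos y → NonNeg (x ⊗ y)
NonNeg-⊗-Pos x y (inj₁ px) py = inj₁ (Pos-⊗ x y px py)
NonNeg-⊗-Pos _ (r , s) (inj₂ refl) _ = inj₂ (cong₂ _,_ (ring₁ r s) (ring₂ r s))
  where
  ring₁ : ∀ r s → + 0 * r + + 0 * s ≡ + 0
  ring₁ = solve-∀
  ring₂ : ∀ r s → + 0 * s + + 0 * r + + 0 * s ≡ + 0
  ring₂ = solve-∀

IsFloorφ : ℕ → ℤ → Set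
IsFloorφ n u = NonNeg (- u , + n) × Pos (u + + 1 , - (+ n))

close-integers-equal : ∀ u v → PosZ (u + + 1 - v) → PosZ (v + + 1 - u) → u ≡ v
close-integers-equal u v u<v+1 v<u+1 =
  trans (sym (ring₃ u v)) (trans (cong (_+ v) (difference-zero (u - v)
    (subst PosZ (ring₁ u v) u<v+1) (subst PosZ (ring₂ u v) v<u+1))) (ZP.+-identityˡ v))
  where
  ring₁ : ∀ u v → u + + 1 - v ≡ + 1 + (u - v)
  ring₁ = solve-∀
  ring₂ : ∀ u v → v + + 1 - u ≡ + 1 - (u - v)
  ring₂ = solve-∀
  ring₃ : ∀ u v → (u - v) + v ≡ u
  ring₃ = solve-∀
  difference-zero : ∀ w → PosZ (+ 1 + w) → PosZ (+ 1 - w) → w ≡ + 0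
  difference-zero (+ zero) _ _ = refl
  difference-zero +[1+ zero ] _ ()
  difference-zero +[1+ suc _ ] _ ()
  difference-zero -[1+ zero ] () _
  difference-zero -[1+ suc _ ] () _

IsFloorφ-unique : ∀ n u v → IsFloorφ n u → IsFloorφ n v → u ≡ v
IsFloorφ-unique n u v (u≤nφ , nφ<u+1) (v≤nφ , nφ<v+1) = close-integers-equal u v
  (Pos-ℤ⁻ _ (Pos-sum-nonneg nφ<u+1 v≤nφ refl (ZP.+-inverseˡ (+ n))))
  (Pos-ℤ⁻ _ (Pos-sum-nonneg nφ<v+1 u≤nφ refl (ZP.+-inverseˡ (+ n))))

-- Since 1 < φ < 2, ⌊(n+1)φ⌋ is ⌊nφ⌋ + 1 or ⌊nφ⌋ + 2.
IsFloorφ-suc : ∀ n m → IsFloorφ n (+ m) →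
               IsFloorφ (suc n) (+ suc m) ⊎ IsFloorφ (suc n) (+ suc (suc m))
IsFloorφ-suc n m (m≤nφ , nφ<m+1) with trichotomy (+ m + + 2 , - (+ suc n))
... | inj₁ lt = inj₁ (inj₁ (Pos-sum-nonneg Pos-φ-1 m≤nφ (ring₁ (+ m)) refl) , Pos-≡ (ring₂ (+ m)) refl lt)
  where
  ring₁ : ∀ m → - (+ 1) + - m ≡ - (+ 1 + m)
  ring₁ = solve-∀
  ring₂ : ∀ m → m + + 2 ≡ (+ 1 + m) + + 1
  ring₂ = solve-∀
... | inj₂ (inj₁ eq) with cong proj₂ eq
... | ()
IsFloorφ-suc n m (m≤nφ , nφ<m+1) | inj₂ (inj₂ ge) =
  inj₂ (inj₁ (Pos-≡ (ring₁ (+ m)) (ring₂ (+ suc n)) ge) ,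
        Pos-sum nφ<m+1 Pos-2-φ (ring₃ (+ m)) (ring₄ (+ n)))
  where
  ring₁ : ∀ m → - (m + + 2) ≡ - (+ 1 + (+ 1 + m))
  ring₁ = solve-∀
  ring₂ : ∀ n → - - n ≡ n
  ring₂ = solve-∀
  ring₃ : ∀ m → m + + 1 + + 2 ≡ (+ 1 + (+ 1 + m)) + + 1
  ring₃ = solve-∀
  ring₄ : ∀ n → - n + - (+ 1) ≡ - (+ 1 + n)
  ring₄ = solve-∀

IsFloorφ-exists : ∀ n → Σ ℕ λ m → IsFloorφ n (+ m)
IsFloorφ-exists zero = 0 , inj₂ refl , (2 , tt , tt)
IsFloorφ-exists (suc n) with IsFloorφ-exists n
... | m , fl = Sum.[ (λ fl′ → suc m , fl′) , (λ fl′ → suc (suc m) , fl′) ] (IsFloorφ-suc n m fl)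

-- The lower Wythoff sequence ⌊nφ⌋ and the upper one ⌊nφ²⌋ = ⌊nφ⌋ + n.
-- floorφ is kept abstract: all its uses go through floorφ-spec, and
-- unfolding the existence proof would only make type checking expensive.
abstract
  floorφ : ℕ → ℕ
  floorφ n = proj₁ (IsFloorφ-exists n)

  floorφ-spec : ∀ n → IsFloorφ n (+ floorφ n)
  floorφ-spec n = proj₂ (IsFloorφ-exists n)

floorφ² : ℕ → ℕ
floorφ² n = floorφ n N.+ n

floorφ-unique : ∀ n m → IsFloorφ n (+ m) → floorφ n ≡ m
floorφ-unique n m fl = ZP.+-injective (IsFloorφ-unique n _ _ (floorφ-spec n) fl)

floorφ-zero : floorφ 0 ≡ 0
floorφ-zero = floorφ-unique 0 0 (inj₂ refl , (2 , tt , tt))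

floorφ-suc : ∀ n → floorφ (suc n) ≡ suc (floorφ n) ⊎ floorφ (suc n) ≡ suc (suc (floorφ n))
floorφ-suc n = Sum.map (floorφ-unique (suc n) _) (floorφ-unique (suc n) _)
  (IsFloorφ-suc n (floorφ n) (floorφ-spec n))

floorφ²-suc : ∀ n → floorφ² (suc n) ≡ floorφ² n N.+ 2 ⊎ floorφ² (suc n) ≡ floorφ² n N.+ 3
floorφ²-suc n = Sum.map (λ e → trans (cong (N._+ suc n) e) (shift₁ (floorφ n) n))
                        (λ e → trans (cong (N._+ suc n) e) (shift₂ (floorφ n) n)) (floorφ-suc n)
  where
  shift₁ : ∀ x y → suc x N.+ suc y ≡ x N.+ y N.+ 2
  shift₁ = NS.solve-∀
  shift₂ : ∀ x y → suc (suc x) N.+ suc y ≡ x N.+ y N.+ 3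
  shift₂ = NS.solve-∀

floorφ²-step : ∀ n → floorφ² n N.< floorφ² (suc n)
floorφ²-step n with floorφ²-suc n
... | inj₁ e = subst (floorφ² n N.<_) (sym e) (NP.m<m+n _ (N.s≤s N.z≤n))
... | inj₂ e = subst (floorφ² n N.<_) (sym e) (NP.m<m+n _ (N.s≤s N.z≤n))

floorφ²-< : ∀ m k → floorφ² m N.< floorφ² (suc (m N.+ k))
floorφ²-< m zero = subst (λ n → floorφ² m N.< floorφ² (suc n)) (sym (NP.+-identityʳ m)) (floorφ²-step m)
floorφ²-< m (suc k) = NP.<-trans (floorφ²-< m k)
  (subst (λ n → floorφ² (suc (m N.+ k)) N.< floorφ² (suc n)) (sym (NP.+-suc m k)) (floorφ²-step _))

-- ⌊(k+d)φ⌋ - ⌊kφ⌋ is ⌊dφ⌋ or ⌊dφ⌋ + 1: compare dφ with the difference.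
IsFloorφ-difference : ∀ k d A ak → IsFloorφ (k N.+ d) (+ A) → IsFloorφ k (+ ak) →
                      IsFloorφ d (+ A - + ak) ⊎ IsFloorφ d (+ A - + ak - + 1)
IsFloorφ-difference k d A ak (A≤ , <A+1) (ak≤ , <ak+1) with NonNeg-or-neg (- (+ A - + ak) , + d)
... | inj₁ ge = inj₁ (ge , Pos-sum-nonneg <A+1 ak≤ (ring₁ (+ A) (+ ak)) (ring₂ _ (+ k) (+ d) (ZP.pos-+ k d)))
  where
  ring₁ : ∀ A K → A + + 1 + - K ≡ A - K + + 1
  ring₁ = solve-∀
  ring₂ : ∀ X K D → X ≡ K + D → - X + K ≡ - D
  ring₂ X K D refl = ring K D
    where
    ring : ∀ K D → - (K + D) + K ≡ - D
    ring = solve-∀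
... | inj₂ lt = inj₂ (NonNeg-sum A≤ (inj₁ <ak+1) (ring₁ (+ A) (+ ak)) (ring₂ _ (+ k) (+ d) (ZP.pos-+ k d)) ,
                      Pos-≡ (ring₃ (+ A) (+ ak)) refl lt)
  where
  ring₁ : ∀ A K → - A + (K + + 1) ≡ - (A - K - + 1)
  ring₁ = solve-∀
  ring₂ : ∀ X K D → X ≡ K + D → X + - K ≡ D
  ring₂ X K D refl = ring K D
    where
    ring : ∀ K D → K + D + - K ≡ D
    ring = solve-∀
  ring₃ : ∀ A K → - - (A - K) ≡ A - K - + 1 + + 1
  ring₃ = solve-∀

floorφ-+ : ∀ k d → Σ ℕ λ t → t N.≤ 1 × floorφ (k N.+ d) ≡ floorφ k N.+ floorφ d N.+ t
floorφ-+ k d with IsFloorφ-difference k d _ _ (floorφ-spec (k N.+ d)) (floorφ-spec k)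
... | inj₁ fl = 0 , N.z≤n , ZP.+-injective (rearrange _ (+ floorφ k) _ (IsFloorφ-unique d _ _ fl (floorφ-spec d)))
  where
  rearrange : ∀ A K D → A - K ≡ D → A ≡ K + D + + 0
  rearrange A K _ refl = ring A K
    where
    ring : ∀ A K → A ≡ K + (A - K) + + 0
    ring = solve-∀
... | inj₂ fl = 1 , NP.≤-refl , ZP.+-injective (rearrange _ (+ floorφ k) _ (IsFloorφ-unique d _ _ fl (floorφ-spec d)))
  where
  rearrange : ∀ A K D → A - K - + 1 ≡ D → A ≡ K + D + + 1
  rearrange A K _ refl = ring A K
    where
    ring : ∀ A K → A ≡ K + (A - K - + 1) + + 1
    ring = solve-∀

floorφ-mono : ∀ k d → floorφ k N.≤ floorφ (k N.+ d)
floorφ-mono k d with floorφ-+ k d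
... | t , _ , e = subst (floorφ k N.≤_) (sym e) (NP.≤-trans (NP.m≤m+n _ (floorφ d)) (NP.m≤m+n _ t))

floorφ²-+ : ∀ k d → Σ ℕ λ t → t N.≤ 1 × floorφ² (k N.+ d) ≡ floorφ² k N.+ (floorφ² d N.+ t)
floorφ²-+ k d with floorφ-+ k d
... | t , t≤1 , e = t , t≤1 , trans (cong (N._+ (k N.+ d)) e) (shuffle (floorφ k) (floorφ d) k d t)
  where
  shuffle : ∀ a b k d t → a N.+ b N.+ t N.+ (k N.+ d) ≡ a N.+ k N.+ (b N.+ d N.+ t)
  shuffle = NS.solve-∀

-- For n ≥ 1 the bound u ≤ nφ is strict (nφ is irrational).
IsFloorφ-strict : ∀ n u → 1 N.≤ n → IsFloorφ n u → Pos (- u , + n)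
IsFloorφ-strict n u _ (inj₁ pos , _) = pos
IsFloorφ-strict (suc n) u _ (inj₂ eq , _) with cong proj₂ eq
... | ()

-- The odd- and even-indexed Fibonacci numbers F_{2i+1} and F_{2i+2}.
fibOdd : ℕ → ℕ
fibEven : ℕ → ℕ
fibOdd zero = 1
fibOdd (suc i) = fibEven i N.+ fibOdd i
fibEven zero = 1
fibEven (suc i) = fibOdd (suc i) N.+ fibEven i

fib-odd-even : ∀ j → fib (suc (2 N.* j)) ≡ fibOdd j × fib (suc (suc (2 N.* j))) ≡ fibEven j
fib-odd-even zero = refl , refl
fib-odd-even (suc j) with fib-odd-even j
... | odd , even = trans (cong (λ t → fib (suc t)) (NP.*-suc 2 j)) next-odd ,
                   trans (cong (λ t → fib (suc (suc t))) (NP.*-suc 2 j)) (cong₂ N._+_ next-odd even)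
  where
  next-odd : fib (suc (suc (suc (2 N.* j)))) ≡ fibOdd (suc j)
  next-odd = cong₂ N._+_ even odd

fib-odd : ∀ j → fib (2 N.* j N.+ 1) ≡ fibOdd j
fib-odd j = trans (cong fib (NP.+-comm (2 N.* j) 1)) (proj₁ (fib-odd-even j))

fibOdd-ℤ : ∀ i → + fibOdd (suc i) ≡ + fibEven i + + fibOdd i
fibOdd-ℤ i = ZP.pos-+ (fibEven i) (fibOdd i)

fibEven-ℤ : ∀ i → + fibEven (suc i) ≡ (+ fibEven i + + fibOdd i) + + fibEven i
fibEven-ℤ i = trans (ZP.pos-+ (fibOdd (suc i)) (fibEven i)) (cong (_+ + fibEven i) (fibOdd-ℤ i))

fibOdd-pos : ∀ i → 1 N.≤ fibOdd i
fibEven-pos : ∀ i → 1 N.≤ fibEven i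
fibOdd-pos zero = N.s≤s N.z≤n
fibOdd-pos (suc i) = NP.≤-trans (fibEven-pos i) (NP.m≤m+n (fibEven i) (fibOdd i))
fibEven-pos zero = N.s≤s N.z≤n
fibEven-pos (suc i) = NP.≤-trans (fibOdd-pos (suc i)) (NP.m≤m+n (fibOdd (suc i)) (fibEven i))

fibOdd-increasing : ∀ i → fibOdd i N.< fibOdd (suc i)
fibOdd-increasing i = NP.m<n+m (fibOdd i) (fibEven-pos i)

cassini : ∀ i → + fibOdd i * + fibOdd (suc i) - + fibEven i * + fibEven i ≡ + 1
cassini zero = refl
cassini (suc i) = begin
  + fibOdd (suc i) * + fibOdd (suc (suc i)) - + fibEven (suc i) * + fibEven (suc i)
    ≡⟨ cong (λ F → + fibOdd (suc i) * F - + fibEven (suc i) * + fibEven (suc i)) (fibOdd-ℤ (suc i)) ⟩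
  + fibOdd (suc i) * (+ fibEven (suc i) + + fibOdd (suc i)) - + fibEven (suc i) * + fibEven (suc i)
    ≡⟨ step (+ fibEven i) (+ fibOdd i) _ _ (fibEven-ℤ i) (fibOdd-ℤ i) ⟩
  + fibOdd i * (+ fibEven i + + fibOdd i) - + fibEven i * + fibEven i
    ≡⟨ cong (λ F → + fibOdd i * F - + fibEven i * + fibEven i) (fibOdd-ℤ i) ⟨
  + fibOdd i * + fibOdd (suc i) - + fibEven i * + fibEven i
    ≡⟨ cassini i ⟩
  + 1 ∎
  where
  open ≡-Reasoning
  step : ∀ H G X Y → X ≡ (H + G) + H → Y ≡ H + G → Y * (X + Y) - X * X ≡ G * (H + G) - H * H
  step H G _ _ refl refl = ring H G
    where
    ring : ∀ H G → (H + G) * ((H + G + H) + (H + G)) - (H + G + H) * (H + G + H) ≡ G * (H + G) - H * H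
    ring = solve-∀

-- The approximation errors of F_{2i+2}/F_{2i+1} (from below) and of
-- F_{2i+3}/F_{2i+2} (from above) to φ:
--   errorBelow i = F_{2i+1}φ - F_{2i+2},   errorAbove i = F_{2i+3} - F_{2i+2}φ.
errorBelow : ℕ → Zφ
errorBelow i = - (+ fibEven i) , + fibOdd i

errorAbove : ℕ → Zφ
errorAbove i = + fibOdd (suc i) , - (+ fibEven i)

timesφ-errorBelow : ∀ i → timesφ (errorBelow (suc i)) ≡ errorAbove i
timesφ-errorBelow i = cong (+ fibOdd (suc i) ,_) (begin
  - (+ fibEven (suc i)) + + fibOdd (suc i)
    ≡⟨ cong (λ z → - z + + fibOdd (suc i)) (ZP.pos-+ (fibOdd (suc i)) (fibEven i)) ⟩
  - (+ fibOdd (suc i) + + fibEven i) + + fibOdd (suc i)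
    ≡⟨ ring (+ fibOdd (suc i)) (+ fibEven i) ⟩
  - (+ fibEven i) ∎)
  where
  open ≡-Reasoning
  ring : ∀ F H → - (F + H) + F ≡ - H
  ring = solve-∀

timesφ-errorAbove : ∀ i → timesφ (errorAbove i) ≡ errorBelow i
timesφ-errorAbove i = cong (- (+ fibEven i) ,_) (begin
  + fibOdd (suc i) + - (+ fibEven i)  ≡⟨ cong (_+ - (+ fibEven i)) (fibOdd-ℤ i) ⟩
  + fibEven i + + fibOdd i + - (+ fibEven i) ≡⟨ ring (+ fibEven i) (+ fibOdd i) ⟩
  + fibOdd i ∎)
  where
  open ≡-Reasoning
  ring : ∀ H G → H + G + - H ≡ G
  ring = solve-∀

-- Hence both errors are positive, by a joint induction from φ - 1 > 0.
Pos-errorBelow : ∀ i → Pos (errorBelow i)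
Pos-errorAbove : ∀ i → Pos (errorAbove i)
Pos-errorBelow zero = Pos-φ-1
Pos-errorBelow (suc i) = Pos-timesφ⁻ _ (subst Pos (sym (timesφ-errorBelow i)) (Pos-errorAbove i))
Pos-errorAbove i = Pos-timesφ⁻ _ (subst Pos (sym (timesφ-errorAbove i)) (Pos-errorBelow i))

-- The errors from below decrease: errorBelow 0 - errorBelow (i+1) > 0, as a
-- sum of the terms errorBelow j - errorBelow (j+1) = errorAbove j.
Pos-errorBelow-drop : ∀ i → Pos (- (+ 1) + + fibEven (suc i) , + 1 - + fibOdd (suc i))
Pos-errorBelow-drop zero = Pos-errorAbove 0
Pos-errorBelow-drop (suc i) = Pos-sum (Pos-errorBelow-drop i) (Pos-errorAbove (suc i))
  (first (+ fibEven (suc i)) (+ fibOdd (suc (suc i))) _ (ZP.pos-+ (fibOdd (suc (suc i))) (fibEven (suc i))))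
  (second (+ fibEven (suc i)) (+ fibOdd (suc i)) _ (fibOdd-ℤ (suc i)))
  where
  first : ∀ H F X → X ≡ F + H → - (+ 1) + H + F ≡ - (+ 1) + X
  first H F _ refl = ring H F
    where
    ring : ∀ H F → - (+ 1) + H + F ≡ - (+ 1) + (F + H)
    ring = solve-∀
  second : ∀ H G X → X ≡ H + G → + 1 - G + - H ≡ + 1 - X
  second H G _ refl = ring H G
    where
    ring : ∀ H G → + 1 - G + - H ≡ + 1 - (H + G)
    ring = solve-∀

NonNeg-errorBelow-drop : ∀ i → NonNeg (- (+ 1) + + fibEven i , + 1 - + fibOdd i)
NonNeg-errorBelow-drop zero = inj₂ refl
NonNeg-errorBelow-drop (suc i) = inj₁ (Pos-errorBelow-drop i)

-- ⌊F_{2i+1}φ⌋ = F_{2i+2}, as 0 < F_{2i+1}φ - F_{2i+2} ≤ φ - 1 < 1.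
floorφ-fibOdd : ∀ i → floorφ (fibOdd i) ≡ fibEven i
floorφ-fibOdd i = floorφ-unique (fibOdd i) (fibEven i)
  (inj₁ (Pos-errorBelow i) ,
   Pos-sum-nonneg Pos-2-φ (NonNeg-errorBelow-drop i) (ring₁ (+ fibEven i)) (ring₂ (+ fibOdd i)))
  where
  ring₁ : ∀ H → + 2 + (- (+ 1) + H) ≡ H + + 1
  ring₁ = solve-∀
  ring₂ : ∀ G → - (+ 1) + (+ 1 - G) ≡ - G
  ring₂ = solve-∀

data SignView : ℤ → Set where
  positive    : ∀ n → SignView (+ suc n)
  nonpositive : ∀ n → SignView (- (+ n))

signView : ∀ z → SignView z
signView +[1+ n ] = positive n
signView (+ zero) = nonpositive 0
signView -[1+ n ] = nonpositive (suc n)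

PosZ-ℕ : ∀ m → 1 N.≤ m → PosZ (+ m)
PosZ-ℕ (suc m) _ = tt

PosZ-difference⇒< : ∀ x y → PosZ (+ x - + y) → y N.< x
PosZ-difference⇒< x y pos with y N.<? x
... | yes y<x = y<x
... | no y≮x = ⊥-elim (PosZ-neg-ℕ (y N.∸ x) (subst PosZ (trans (ZP.m-n≡m⊖n x y) (ZP.⊖-≤ (NP.≮⇒≥ y≮x))) pos))
  where
  PosZ-neg-ℕ : ∀ n → PosZ (- (+ n)) → ⊥
  PosZ-neg-ℕ zero ()
  PosZ-neg-ℕ (suc n) ()

<⇒PosZ-difference : ∀ x y → y N.< x → PosZ (+ x - + y)
<⇒PosZ-difference x y y<x with NP.m≤n⇒∃[o]m+o≡n y<x
... | k , refl = subst PosZ (sym (ring (+ y) (+ k))) tt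
  where
  ring : ∀ y k → + 1 + y + k - y ≡ + 1 + k
  ring = solve-∀

module _ (i : ℕ) where
  private
    G H F : ℤ
    G = + fibOdd i
    H = + fibEven i
    F = + fibOdd (suc i)

    NonNeg-integer-combination : ∀ u v → NonNeg (+ u * G + + v * H , + u * + 0 + + v * + 0)
    NonNeg-integer-combination u v = NonNeg-sum (NonNeg-⊙ u (G , + 0) (NonNeg-ℕ (fibOdd i)))
      (NonNeg-⊙ v (H , + 0) (NonNeg-ℕ (fibEven i))) refl refl

    zero-combination : ∀ U V → + 0 ≡ - (U * + 0 + V * + 0)
    zero-combination = solve-∀

  -- Write m = uG + vH and p = uH + vF in the basis (G, H), (H, F) of ℤ²
  -- (G = F_{2i+1}, H = F_{2i+2}, F = F_{2i+3}); then
  -- mφ - p = u·errorBelow i - v·errorAbove i.  If mφ - p > 0 and 1 ≤ m < F,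
  -- the signs force u ≥ 1 and v ≤ 0, whence mφ - p ≥ errorBelow i.
  best-approximation-coords : ∀ m p u v → + m ≡ u * + fibOdd i + v * + fibEven i →
    p ≡ u * + fibEven i + v * + fibOdd (suc i) → Pos (- p , + m) → 1 N.≤ m → m N.< fibOdd (suc i) →
    NonNeg (- p + + fibEven i , + m - + fibOdd i)
  best-approximation-coords m p u v em ep pos 1≤m m<F with signView u | signView v
  ... | positive u′ | nonpositive v′ =
    NonNeg-sum (NonNeg-⊙ u′ (errorBelow i) (inj₁ (Pos-errorBelow i)))
               (NonNeg-⊙ v′ (errorAbove i) (inj₁ (Pos-errorAbove i)))
               (first (+ u′) (+ v′) G H F _ _ em ep) (second (+ u′) (+ v′) G H F _ _ em ep)
    where
    first : ∀ U V G H F M P → M ≡ (+ 1 + U) * G + - V * H → P ≡ (+ 1 + U) * H + - V * F →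
            U * - H + V * F ≡ - P + H
    first U V G H F _ _ refl refl = ring U V H F
      where
      ring : ∀ U V H F → U * - H + V * F ≡ - ((+ 1 + U) * H + - V * F) + H
      ring = solve-∀
    second : ∀ U V G H F M P → M ≡ (+ 1 + U) * G + - V * H → P ≡ (+ 1 + U) * H + - V * F →
             U * G + V * - H ≡ M - G
    second U V G H F _ _ refl refl = ring U V G H
      where
      ring : ∀ U V G H → U * G + V * - H ≡ (+ 1 + U) * G + - V * H - G
      ring = solve-∀
  ... | positive u′ | positive v′ =
    ⊥-elim (NonNeg-contradiction (NonNeg-integer-combination u′ v′) (Pos-ℤ _ (<⇒PosZ-difference _ _ m<F))
      (excess (+ u′) (+ v′) G H F _ em (fibOdd-ℤ i)) (zero-combination (+ u′) (+ v′)))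
    where
    excess : ∀ U V G H F M → M ≡ (+ 1 + U) * G + (+ 1 + V) * H → F ≡ H + G → F - M ≡ - (U * G + V * H)
    excess U V G H _ _ refl refl = ring U V G H
      where
      ring : ∀ U V G H → H + G - ((+ 1 + U) * G + (+ 1 + V) * H) ≡ - (U * G + V * H)
      ring = solve-∀
  ... | nonpositive u′ | positive v′ =
    ⊥-elim (NonNeg-contradiction
      (NonNeg-sum (NonNeg-⊙ u′ (errorBelow i) (inj₁ (Pos-errorBelow i)))
                  (inj₁ (Pos-⊙ v′ (errorAbove i) (Pos-errorAbove i))) refl refl)
      pos (first (+ u′) (+ v′) H F _ ep) (second (+ u′) (+ v′) G H _ em))
    where
    first : ∀ U V H F P → P ≡ - U * H + (+ 1 + V) * F → - P ≡ - (U * - H + (+ 1 + V) * F)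
    first U V H F _ refl = ring U V H F
      where
      ring : ∀ U V H F → - (- U * H + (+ 1 + V) * F) ≡ - (U * - H + (+ 1 + V) * F)
      ring = solve-∀
    second : ∀ U V G H M → M ≡ - U * G + (+ 1 + V) * H → M ≡ - (U * G + (+ 1 + V) * - H)
    second U V G H _ refl = ring U V G H
      where
      ring : ∀ U V G H → - U * G + (+ 1 + V) * H ≡ - (U * G + (+ 1 + V) * - H)
      ring = solve-∀
  ... | nonpositive u′ | nonpositive v′ =
    ⊥-elim (NonNeg-contradiction (NonNeg-integer-combination u′ v′) (Pos-ℤ _ (PosZ-ℕ m 1≤m))
      (negative (+ u′) (+ v′) G H _ em) (zero-combination (+ u′) (+ v′)))
    where
    negative : ∀ U V G H M → M ≡ - U * G + - V * H → M ≡ - (U * G + V * H)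
    negative U V G H _ refl = ring U V G H
      where
      ring : ∀ U V G H → - U * G + - V * H ≡ - (U * G + V * H)
      ring = solve-∀

  -- Best approximation: for 1 ≤ m < F_{2i+3}, mφ - ⌊mφ⌋ ≥ F_{2i+1}φ - F_{2i+2}.
  -- The coordinates in the basis (G, H), (H, F) are obtained from Cassini.
  best-approximation : ∀ m → 1 N.≤ m → m N.< fibOdd (suc i) →
                       NonNeg (- (+ floorφ m) + + fibEven i , + m - + fibOdd i)
  best-approximation m 1≤m m<F =
    best-approximation-coords m p u v em ep (IsFloorφ-strict m _ 1≤m (floorφ-spec m)) 1≤m m<F
    where
    M p u v : ℤ
    M = + m
    p = + floorφ m
    u = M * F - p * H
    v = p * G - M * H
    ring₁ : ∀ M p G H F → (M * F - p * H) * G + (p * G - M * H) * H ≡ M * (G * F - H * H)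
    ring₁ = solve-∀
    ring₂ : ∀ M p G H F → (M * F - p * H) * H + (p * G - M * H) * F ≡ p * (G * F - H * H)
    ring₂ = solve-∀
    em : M ≡ u * G + v * H
    em = sym (trans (ring₁ M p G H F) (trans (cong (M *_) (cassini i)) (ZP.*-identityʳ M)))
    ep : p ≡ u * H + v * F
    ep = sym (trans (ring₂ M p G H F) (trans (cong (p *_) (cassini i)) (ZP.*-identityʳ p)))

  IsFloorφ-shift : ∀ k → fibOdd i N.+ k N.< fibOdd (suc i) →
                   IsFloorφ k (+ floorφ (fibOdd i N.+ k) - + fibEven i)
  IsFloorφ-shift k m<F =
    NonNeg-≡ (ring₁ (+ floorφ m) H) (trans (cong (_- G) (ZP.pos-+ (fibOdd i) k)) (ring₂ G (+ k)))
      (best-approximation m (NP.≤-trans (fibOdd-pos i) (NP.m≤m+n (fibOdd i) k)) m<F) ,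
    Pos-sum (proj₂ (floorφ-spec m)) (Pos-errorBelow i)
      (ring₃ (+ floorφ m) H) (trans (cong (λ z → - z + G) (ZP.pos-+ (fibOdd i) k)) (ring₄ G (+ k)))
    where
    m : ℕ
    m = fibOdd i N.+ k
    ring₁ : ∀ A H → - A + H ≡ - (A - H)
    ring₁ = solve-∀
    ring₂ : ∀ G K → G + K - G ≡ K
    ring₂ = solve-∀
    ring₃ : ∀ A H → A + + 1 + - H ≡ A - H + + 1
    ring₃ = solve-∀
    ring₄ : ∀ G K → - (G + K) + G ≡ - K
    ring₄ = solve-∀

fibOdd-bracket : ∀ m → 1 N.≤ m → Σ ℕ λ i → fibOdd i N.≤ m × m N.< fibOdd (suc i)
fibOdd-bracket (suc zero) _ = 0 , NP.≤-refl , N.s≤s (N.s≤s N.z≤n)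
fibOdd-bracket (suc (suc m)) _ with fibOdd-bracket (suc m) (N.s≤s N.z≤n)
... | i , lower , upper with NP.m≤n⇒m<n∨m≡n upper
... | inj₁ upper′ = i , NP.m≤n⇒m≤1+n lower , upper′
... | inj₂ m+2≡F = suc i , NP.≤-reflexive (sym m+2≡F) ,
  subst (N._< fibOdd (suc (suc i))) (sym m+2≡F) (fibOdd-increasing (suc i))

InS-fibOdd : ∀ s → InS s → Σ ℕ λ i → suc s ≡ fibOdd (suc i)
InS-fibOdd s (suc i , _ , s≡) = i , (begin
  suc s                             ≡⟨ cong suc s≡ ⟩
  suc (fib (2 N.* suc i N.+ 1) N.∸ 1) ≡⟨ cong (λ f → suc (f N.∸ 1)) (fib-odd (suc i)) ⟩
  suc (fibOdd (suc i) N.∸ 1)        ≡⟨ NP.m+[n∸m]≡n (fibOdd-pos (suc i)) ⟩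
  fibOdd (suc i) ∎)
  where open ≡-Reasoning

fibOdd-InS : ∀ i → InS (fibOdd (suc i) N.∸ 1)
fibOdd-InS i = suc i , N.s≤s N.z≤n , cong (N._∸ 1) (sym (fib-odd (suc i)))

InS-pos : ∀ s → InS s → 1 N.≤ s
InS-pos s inS with InS-fibOdd s inS
... | i , s+1≡F = NP.≤-pred (subst (2 N.≤_) (sym s+1≡F) (NP.+-mono-≤ (fibEven-pos i) (fibOdd-pos i)))

floorφ²-lower : ∀ i e → fibOdd (suc i) N.≤ floorφ² (fibOdd i N.+ e)
floorφ²-lower i e = NP.+-mono-≤ fe≤floor (NP.m≤m+n (fibOdd i) e)
  where
  fe≤floor : fibEven i N.≤ floorφ (fibOdd i N.+ e)
  fe≤floor = subst (N._≤ floorφ (fibOdd i N.+ e)) (floorφ-fibOdd i) (floorφ-mono (fibOdd i) e)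

-- The upper bound uses ⌊dφ⌋ ≤ dφ and errorBelow (i+1) < errorBelow 0 = φ - 1:
-- with F_{2i+3} = d + e + 1 their sum gives ⌊dφ⌋ + 1 < F_{2i+4} + e.
floorφ²-upper : ∀ i d e → fibOdd (suc i) ≡ suc (d N.+ e) → floorφ² d N.+ 3 N.≤ fibOdd (suc (suc i))
floorφ²-upper i d e F≡ = arithmetic (PosZ-difference⇒< _ _ (Pos-ℤ⁻ _ (subst Pos components pos)))
  where
  pos : Pos (- (+ floorφ d) + (- (+ 1) + + fibEven (suc i)) + + e , + d + (+ 1 - + fibOdd (suc i)) + + e)
  pos = Pos-sum-nonneg (NonNeg-⊕-Pos _ _ (proj₁ (floorφ-spec d)) (Pos-errorBelow-drop i)) (NonNeg-ℕ-diagonal e) refl refl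
  F≡ℤ : + fibOdd (suc i) ≡ + 1 + (+ d + + e)
  F≡ℤ = trans (cong +_ F≡) (trans (ZP.pos-+ 1 (d N.+ e)) (cong (λ z → + 1 + z) (ZP.pos-+ d e)))
  cancel : ∀ A H E D G → G ≡ + 1 + (D + E) →
           (- A + (- (+ 1) + H) + E , D + (+ 1 - G) + E) ≡ (H + E - (A + + 1) , + 0)
  cancel A H E D _ refl = cong₂ _,_ (ring₁ A H E) (ring₂ D E)
    where
    ring₁ : ∀ A H E → - A + (- (+ 1) + H) + E ≡ H + E - (A + + 1)
    ring₁ = solve-∀
    ring₂ : ∀ D E → D + (+ 1 - (+ 1 + (D + E))) + E ≡ + 0
    ring₂ = solve-∀
  components : (- (+ floorφ d) + (- (+ 1) + + fibEven (suc i)) + + e , + d + (+ 1 - + fibOdd (suc i)) + + e)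
             ≡ (+ (fibEven (suc i) N.+ e) - + (floorφ d N.+ 1) , + 0)
  components = trans (cancel (+ floorφ d) (+ fibEven (suc i)) (+ e) (+ d) _ F≡ℤ)
    (cong₂ (λ x y → x - y , + 0) (sym (ZP.pos-+ (fibEven (suc i)) e)) (sym (ZP.pos-+ (floorφ d) 1)))
  arithmetic : floorφ d N.+ 1 N.< fibEven (suc i) N.+ e → floorφ² d N.+ 3 N.≤ fibOdd (suc (suc i))
  arithmetic lt = begin
    floorφ d N.+ d N.+ 3              ≡⟨ shuffle₁ (floorφ d) d ⟩
    suc (floorφ d N.+ 1) N.+ suc d    ≤⟨ NP.+-monoˡ-≤ (suc d) lt ⟩
    fibEven (suc i) N.+ e N.+ suc d   ≡⟨ shuffle₂ (fibEven (suc i)) e d ⟩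
    fibEven (suc i) N.+ suc (d N.+ e) ≡⟨ cong (fibEven (suc i) N.+_) F≡ ⟨
    fibOdd (suc (suc i))              ∎
    where
    open NP.≤-Reasoning
    shuffle₁ : ∀ a d → a N.+ d N.+ 3 ≡ suc (a N.+ 1) N.+ suc d
    shuffle₁ = NS.solve-∀
    shuffle₂ : ∀ h e d → h N.+ e N.+ suc d ≡ h N.+ suc (d N.+ e)
    shuffle₂ = NS.solve-∀

-- For d ≥ 1 neither ⌊dφ²⌋ nor ⌊dφ²⌋ + 1 lies in S: by the two bounds above,
-- ⌊dφ²⌋ + t + 1 (t ≤ 1) is either > F_{2i+3} or < F_{2i+3}.
floorφ²-avoids-S : ∀ i d t → 1 N.≤ d → t N.≤ 1 → suc (floorφ² d N.+ t) ≢ fibOdd (suc i)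
floorφ²-avoids-S i d t 1≤d t≤1 eq with d N.<? fibOdd i
floorφ²-avoids-S zero d t 1≤d t≤1 eq | yes d<1 = NP.<⇒≱ d<1 1≤d
floorφ²-avoids-S (suc i) d t 1≤d t≤1 eq | yes d<G with NP.m≤n⇒∃[o]m+o≡n d<G
... | e , G≡ = NP.<-irrefl refl (begin-strict
  fibOdd (suc (suc i))       ≡⟨ eq ⟨
  suc (floorφ² d N.+ t)      ≤⟨ N.s≤s (NP.+-monoʳ-≤ (floorφ² d) t≤1) ⟩
  suc (floorφ² d N.+ 1)      <⟨ NP.≤-reflexive (shuffle (floorφ² d)) ⟩
  floorφ² d N.+ 3            ≤⟨ floorφ²-upper i d e (sym G≡) ⟩
  fibOdd (suc (suc i))       ∎)
  where
  open NP.≤-Reasoning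
  shuffle : ∀ x → suc (suc (x N.+ 1)) ≡ x N.+ 3
  shuffle = NS.solve-∀
floorφ²-avoids-S i d t 1≤d t≤1 eq | no d≮G with NP.m≤n⇒∃[o]m+o≡n (NP.≮⇒≥ d≮G)
... | e , refl = NP.<-irrefl refl (begin-strict
  fibOdd (suc i)                         ≤⟨ floorφ²-lower i e ⟩
  floorφ² (fibOdd i N.+ e)               <⟨ N.s≤s (NP.m≤m+n _ t) ⟩
  suc (floorφ² (fibOdd i N.+ e) N.+ t)   ≡⟨ eq ⟩
  fibOdd (suc i)                         ∎)
  where open NP.≤-Reasoning

floorφ²-difference-∉S : ∀ k n s → InS s → floorφ² n ≢ floorφ² k N.+ s
floorφ²-difference-∉S k n s inS eq with N.compare n k
... | N.less n j = NP.<-irrefl refl (begin-strict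
  floorφ² n                  <⟨ floorφ²-< n j ⟩
  floorφ² (suc (n N.+ j))    ≤⟨ NP.m≤m+n _ s ⟩
  floorφ² (suc (n N.+ j)) N.+ s ≡⟨ eq ⟨
  floorφ² n                  ∎)
  where open NP.≤-Reasoning
... | N.equal n = NP.<-irrefl refl (begin-strict
  floorφ² n                  <⟨ NP.m<m+n _ (InS-pos s inS) ⟩
  floorφ² n N.+ s            ≡⟨ eq ⟨
  floorφ² n                  ∎)
  where open NP.≤-Reasoning
... | N.greater k j with floorφ²-+ k (suc j) | InS-fibOdd s inS
... | t , t≤1 , split | i , s+1≡F =
  floorφ²-avoids-S i (suc j) t (N.s≤s N.z≤n) t≤1 (trans (cong suc difference) s+1≡F)
  where
  difference : floorφ² (suc j) N.+ t ≡ s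
  difference = NP.+-cancelˡ-≡ (floorφ² k) _ _
    (trans (sym split) (trans (cong floorφ² (NP.+-suc k j)) eq))

-- Take F_{2i+1} ≤ n+1 < F_{2i+3}, k = n + 1 - F_{2i+1} and
-- s = F_{2i+3} - 1, and use ⌊kφ⌋ = ⌊(n+1)φ⌋ - F_{2i+2} = ⌊nφ⌋ + 2 - F_{2i+2}.
gap-bridged-by-S : ∀ n → floorφ² (suc n) ≡ floorφ² n N.+ 3 →
                   Σ ℕ λ s → InS s × Σ ℕ λ k → floorφ² k N.+ s ≡ floorφ² n N.+ 2
gap-bridged-by-S n gap with fibOdd-bracket (suc n) (N.s≤s N.z≤n)
... | i , lower , upper with NP.m≤n⇒∃[o]m+o≡n lower
... | k , G+k≡ = fibOdd (suc i) N.∸ 1 , fibOdd-InS i , k , ZP.+-injective total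
  where
  jump : floorφ (suc n) ≡ suc (suc (floorφ n))
  jump with floorφ-suc n
  ... | inj₂ e = e
  ... | inj₁ e with NP.+-cancelˡ-≡ (floorφ² n) 3 2
                      (trans (sym gap) (trans (cong (N._+ suc n) e) (shuffle (floorφ n) n)))
    where
    shuffle : ∀ a n → suc a N.+ suc n ≡ a N.+ n N.+ 2
    shuffle = NS.solve-∀
  ... | ()
  floor-k : + floorφ k ≡ + floorφ (suc n) - + fibEven i
  floor-k = IsFloorφ-unique k _ _ (floorφ-spec k)
    (subst (λ m → IsFloorφ k (+ floorφ m - + fibEven i)) G+k≡
      (IsFloorφ-shift i k (subst (N._< fibOdd (suc i)) (sym G+k≡) upper)))
  s-ℤ : + (fibOdd (suc i) N.∸ 1) ≡ + fibOdd (suc i) - + 1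
  s-ℤ = trans (sym (ZP.⊖-≥ (fibOdd-pos (suc i)))) (sym (ZP.m-n≡m⊖n (fibOdd (suc i)) 1))
  arithmetic : ∀ Ak K S A′ H G A N F → Ak ≡ A′ - H → S ≡ F - + 1 → F ≡ H + G →
               A′ ≡ + 2 + A → G + K ≡ + 1 + N → Ak + K + S ≡ A + N + + 2
  arithmetic _ K _ _ H G A N _ refl refl refl refl G+K≡ =
    trans (ring₁ A H G K) (trans (cong (λ z → A + z + + 1) G+K≡) (ring₂ A N))
    where
    ring₁ : ∀ A H G K → + 2 + A - H + K + (H + G - + 1) ≡ A + (G + K) + + 1
    ring₁ = solve-∀
    ring₂ : ∀ A N → A + (+ 1 + N) + + 1 ≡ A + N + + 2
    ring₂ = solve-∀
  total : + floorφ k + + k + + (fibOdd (suc i) N.∸ 1) ≡ + floorφ n + + n + + 2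
  total = arithmetic _ (+ k) _ _ (+ fibEven i) (+ fibOdd i) (+ floorφ n) (+ n) _
    floor-k s-ℤ (fibOdd-ℤ i) (cong +_ jump) (trans (sym (ZP.pos-+ (fibOdd i) k)) (cong +_ G+k≡))

record Offset (x : ℕ) : Set where
  constructor offset
  field
    base  : ℕ
    shift : ℕ
    x≡    : x ≡ floorφ² base N.+ shift
    below : x N.< floorφ² (suc base)

open Offset using (shift)

offset-of : ∀ x → Offset x
offset-of zero = offset 0 0 0≡ (subst (N._< floorφ² 1) (trans (sym (NP.+-identityʳ _)) (sym 0≡)) (floorφ²-step 0))
  where
  0≡ : 0 ≡ floorφ² 0 N.+ 0
  0≡ = cong (λ a → a N.+ 0 N.+ 0) (sym floorφ-zero)
offset-of (suc x) with offset-of x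
... | offset n c x≡ x< with NP.m≤n⇒m<n∨m≡n x<
... | inj₁ x+1< = offset n (suc c) (trans (cong suc x≡) (sym (NP.+-suc _ c))) x+1<
... | inj₂ x+1≡ = offset (suc n) 0 (trans x+1≡ (sym (NP.+-identityʳ _)))
  (subst (N._< floorφ² (suc (suc n))) (sym x+1≡) (floorφ²-step (suc n)))

floorφ²-suc-≤ : ∀ n → floorφ² (suc n) N.≤ floorφ² n N.+ 3
floorφ²-suc-≤ n with floorφ²-suc n
... | inj₁ e = NP.≤-trans (NP.≤-reflexive e) (NP.+-monoʳ-≤ (floorφ² n) (NP.n≤1+n 2))
... | inj₂ e = NP.≤-reflexive e

small-shift-below : ∀ n c → c N.≤ 1 → floorφ² n N.+ c N.< floorφ² (suc n)
small-shift-below n c c≤1 with floorφ²-suc n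
... | inj₁ e = subst (floorφ² n N.+ c N.<_) (sym e) (NP.+-monoʳ-< (floorφ² n) (N.s≤s c≤1))
... | inj₂ e = subst (floorφ² n N.+ c N.<_) (sym e) (NP.+-monoʳ-< (floorφ² n) (NP.m≤n⇒m≤1+n (N.s≤s c≤1)))

shift-≤2 : ∀ n c → floorφ² n N.+ c N.< floorφ² (suc n) → c N.≤ 2
shift-≤2 n c below = NP.≤-pred (NP.+-cancelˡ-< (floorφ² n) c 3 (NP.<-≤-trans below (floorφ²-suc-≤ n)))

gap-after-shift-2 : ∀ n → floorφ² n N.+ 2 N.< floorφ² (suc n) → floorφ² (suc n) ≡ floorφ² n N.+ 3
gap-after-shift-2 n below with floorφ²-suc n
... | inj₂ e = e
... | inj₁ e = ⊥-elim (NP.<-irrefl refl (subst (floorφ² n N.+ 2 N.<_) e below))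

one-InS : InS 1
one-InS = 1 , NP.≤-refl , refl

same-shift-unreachable : ∀ n k c s → InS s → s N.≤ floorφ² n N.+ c →
                         floorφ² n N.+ c N.∸ s ≡ floorφ² k N.+ c → ⊥
same-shift-unreachable n k c s inS s≤x y≡ = floorφ²-difference-∉S k n s inS
  (NP.+-cancelʳ-≡ c _ _ (begin
    floorφ² n N.+ c                    ≡⟨ NP.m∸n+n≡m s≤x ⟨
    floorφ² n N.+ c N.∸ s N.+ s        ≡⟨ cong (N._+ s) y≡ ⟩
    floorφ² k N.+ c N.+ s              ≡⟨ shuffle (floorφ² k) c s ⟩
    floorφ² k N.+ s N.+ c              ∎))
  where
  open ≡-Reasoning
  shuffle : ∀ b c s → b N.+ c N.+ s ≡ b N.+ s N.+ c
  shuffle = NS.solve-∀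

module _ (g : ℕ → ℕ) (isSG : IsSGFunction InS g) where

  Reach : ℕ → ℕ → Set
  Reach x v = Σ ℕ λ s → InS s × s N.≤ x × g (x N.∸ s) ≡ v

  mex-value : ∀ x v → ¬ Reach x v → (∀ j → j N.< v → Reach x j) → g x ≡ v
  mex-value x v unreachable reachable with NP.<-cmp (g x) v
  ... | tri< lt _ _ = ⊥-elim (proj₁ (isSG x) (reachable (g x) lt))
  ... | tri≈ _ e _ = e
  ... | tri> _ _ gt = ⊥-elim (unreachable (proj₂ (isSG x) v gt))

  ValuesBelow : ℕ → Set
  ValuesBelow x = ∀ {y} → y N.< x → (o : Offset y) → g y ≡ shift o

  -- No move from ⌊nφ²⌋ + c reaches value c: it would land on a position
  -- with the same shift.
  shift-unreachable : ∀ n c → ValuesBelow (floorφ² n N.+ c) → ¬ Reach (floorφ² n N.+ c) c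
  shift-unreachable n c ih (s , inS , s≤x , gy≡c) with offset-of (floorφ² n N.+ c N.∸ s)
  ... | o@(offset k c′ y≡ _) = same-shift-unreachable n k c s inS s≤x
    (trans y≡ (cong (floorφ² k N.+_) (trans (sym (ih (NP.∸-monoʳ-< (InS-pos s inS) s≤x) o)) gy≡c)))

  value-at-base : ∀ {x} → ValuesBelow x → ∀ k → floorφ² k N.< x → g (floorφ² k) ≡ 0
  value-at-base ih k lt = ih lt (offset k 0 (sym (NP.+-identityʳ _)) (floorφ²-step k))

  move-to-base : ∀ k s → InS s → ValuesBelow (floorφ² k N.+ s) → Reach (floorφ² k N.+ s) 0
  move-to-base k s inS ih =
    s , inS , NP.m≤n+m s _ ,
    trans (cong g (NP.m+n∸n≡m (floorφ² k) s)) (value-at-base ih k (NP.m<m+n _ (InS-pos s inS)))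

  -- Every value below the shift is reached: 0 by moving to ⌊nφ²⌋ (with s = 1,
  -- or across a gap of 3 by gap-bridged-by-S), and 1 by moving to ⌊nφ²⌋ + 1.
  smaller-shifts-reachable : ∀ n c → floorφ² n N.+ c N.< floorφ² (suc n) → ValuesBelow (floorφ² n N.+ c) →
                             ∀ j → j N.< c → Reach (floorφ² n N.+ c) j
  smaller-shifts-reachable n 1 _ ih zero _ = move-to-base n 1 one-InS ih
  smaller-shifts-reachable n 2 below ih zero _ = reach (gap-bridged-by-S n (gap-after-shift-2 n below))
    where
    reach : (Σ ℕ λ s → InS s × Σ ℕ λ k → floorφ² k N.+ s ≡ floorφ² n N.+ 2) → Reach (floorφ² n N.+ 2) 0
    reach (s , inS , k , bridge) = subst (λ x → Reach x 0) bridge (move-to-base k s inS (subst ValuesBelow (sym bridge) ih))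
  smaller-shifts-reachable n 2 below ih (suc zero) _ =
    1 , one-InS , NP.≤-trans (N.s≤s N.z≤n) (NP.m≤n+m 2 (floorφ² n)) ,
    trans (cong g (NP.+-∸-assoc (floorφ² n) (NP.m≤n+m 1 1)))
          (ih (NP.+-monoʳ-< (floorφ² n) NP.≤-refl) (offset n 1 refl (NP.<-trans (NP.+-monoʳ-< (floorφ² n) NP.≤-refl) below)))
  smaller-shifts-reachable n 0 _ _ _ ()
  smaller-shifts-reachable n 1 _ _ (suc j) (N.s≤s ())
  smaller-shifts-reachable n 2 _ _ (suc (suc j)) (N.s≤s (N.s≤s ()))
  smaller-shifts-reachable n (suc (suc (suc c))) below _ _ _ =
    ⊥-elim (NP.<⇒≱ (N.s≤s (N.s≤s (N.s≤s N.z≤n))) (shift-≤2 n _ below))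

  grundy-offset : ∀ x (o : Offset x) → g x ≡ shift o
  grundy-offset = <-rec _ step
    where
    step : ∀ x → ValuesBelow x → (o : Offset x) → g x ≡ shift o
    step _ ih (offset n c refl below) =
      mex-value _ c (shift-unreachable n c ih) (smaller-shifts-reachable n c below ih)

-- c + b√5 ∈ ℤ[φ], using √5 = 2φ - 1.
infix 5 _+√5_
_+√5_ : ℤ → ℤ → Zφ
c +√5 b = c - b , + 2 * b

conjugate-product : ∀ c b → (c +√5 (- b)) ⊗ (c +√5 b) ≡ (c * c - + 5 * (b * b) , + 0)
conjugate-product c b = cong₂ _,_ (ring₁ c b) (ring₂ c b)
  where
  ring₁ : ∀ c b → (c - - b) * (c - b) + (+ 2 * - b) * (+ 2 * b) ≡ c * c - + 5 * (b * b)
  ring₁ = solve-∀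
  ring₂ : ∀ c b → (c - - b) * (+ 2 * b) + (+ 2 * - b) * (c - b) + (+ 2 * - b) * (+ 2 * b) ≡ + 0
  ring₂ = solve-∀

five-b² : ∀ b → + 5 * (+ b * + b) ≡ + (5 N.* (b N.* b))
five-b² b = trans (cong (+ 5 *_) (sym (ZP.pos-* b b))) (sym (ZP.pos-* 5 (b N.* b)))

square-difference : ∀ c b → + c * + c - + 5 * (+ b * + b) ≡ + (c N.* c) - + (5 N.* (b N.* b))
square-difference c b = cong₂ _-_ (sym (ZP.pos-* c c)) (five-b² b)

NonNeg-√5 : ∀ b → NonNeg (+ 0 +√5 + b)
NonNeg-√5 b = NonNeg-≡ (ring (+ b)) (ZP.*-comm (+ b) (+ 2)) (NonNeg-⊙ b (- (+ 1) , + 2) (inj₁ (1 , tt , tt)))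
  where
  ring : ∀ b → b * - (+ 1) ≡ + 0 - b
  ring = solve-∀

Pos-+√5 : ∀ c b → 1 N.≤ c → Pos (+ c +√5 + b)
Pos-+√5 (suc c) b _ = Pos-sum-nonneg (Pos-ℤ (+ suc c) tt) (NonNeg-√5 b) (ring (+ suc c) (+ b)) (ZP.+-identityˡ _)
  where
  ring : ∀ c b → c + (+ 0 - b) ≡ c - b
  ring = solve-∀

difference-ℤ : ∀ x y z → x N.+ z ≡ y → + z ≡ + y - + x
difference-ℤ x _ z refl = trans (ring (+ x) (+ z)) (cong (_- + x) (sym (ZP.pos-+ x z)))
  where
  ring : ∀ x z → z ≡ x + z - x
  ring = solve-∀

NonNeg-difference⇒≤ : ∀ x y → NonNeg (+ x - + y , + 0) → y N.≤ x
NonNeg-difference⇒≤ x y nn with y N.≤? x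
... | yes y≤x = y≤x
... | no y≰x = ⊥-elim (NonNeg-contradiction nn (Pos-ℤ _ (<⇒PosZ-difference y x (NP.≰⇒> y≰x)))
                         (ring (+ x) (+ y)) refl)
  where
  ring : ∀ x y → y - x ≡ - (x - y)
  ring = solve-∀

√5-lower : ∀ c b → c N.* c N.≤ 5 N.* (b N.* b) → NonNeg (- (+ c) +√5 + b)
√5-lower zero b _ = NonNeg-√5 b
√5-lower (suc c) b c²≤5b² with NonNeg-or-neg (- (+ suc c) +√5 + b)
... | inj₁ nn = nn
... | inj₂ c>b√5 = ⊥-elim (NP.<⇒≱ (PosZ-difference⇒< _ _ (Pos-ℤ⁻ _ product)) c²≤5b²)
  where
  product : Pos (+ (suc c N.* suc c) - + (5 N.* (b N.* b)) , + 0)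
  product = subst Pos (trans (conjugate-product (+ suc c) (+ b)) (cong (_, + 0) (square-difference (suc c) b)))
    (Pos-⊗ _ _ (Pos-≡ (ring₁ (+ suc c) (+ b)) (ring₂ (+ b)) c>b√5) (Pos-+√5 (suc c) b (N.s≤s N.z≤n)))
    where
    ring₁ : ∀ c b → - (- c - b) ≡ c - - b
    ring₁ = solve-∀
    ring₂ : ∀ b → - (+ 2 * b) ≡ + 2 * - b
    ring₂ = solve-∀

√5-upper : ∀ c b → 5 N.* (b N.* b) N.< c N.* c → Pos (+ c +√5 - (+ b))
√5-upper zero b ()
√5-upper (suc c) b 5b²<c² with NonNeg-or-neg (- (+ suc c) +√5 + b)
... | inj₂ c>b√5 = Pos-≡ (ring₁ (+ suc c) (+ b)) (ring₂ (+ b)) c>b√5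
  where
  ring₁ : ∀ c b → - (- c - b) ≡ c - - b
  ring₁ = solve-∀
  ring₂ : ∀ b → - (+ 2 * b) ≡ + 2 * - b
  ring₂ = solve-∀
... | inj₁ b√5≥c = ⊥-elim (NP.<⇒≱ 5b²<c² (NonNeg-difference⇒≤ _ _ product))
  where
  ring₁ : ∀ c b → (- c - b) * (c - b) + (+ 2 * b) * (+ 2 * b) ≡ + 5 * (b * b) - c * c
  ring₁ = solve-∀
  ring₂ : ∀ c b → (- c - b) * (+ 2 * b) + (+ 2 * b) * (c - b) + (+ 2 * b) * (+ 2 * b) ≡ + 0
  ring₂ = solve-∀
  product : NonNeg (+ (5 N.* (b N.* b)) - + (suc c N.* suc c) , + 0)
  product = NonNeg-≡ (trans (ring₁ (+ suc c) (+ b)) (cong₂ _-_ (five-b² b) (sym (ZP.pos-* (suc c) (suc c))))) (ring₂ (+ suc c) (+ b))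
    (NonNeg-⊗-Pos _ _ b√5≥c (Pos-+√5 (suc c) b (N.s≤s N.z≤n)))

FloorHalfSqrt5-lower : ∀ a b m → (2 N.* m N.∸ a) N.* (2 N.* m N.∸ a) N.≤ 5 N.* (b N.* b) →
                       NonNeg (+ a - + (2 N.* m) +√5 + b)
FloorHalfSqrt5-lower a b m sq≤ with NP.≤-total a (2 N.* m)
... | inj₁ a≤2m with NP.m≤n⇒∃[o]m+o≡n a≤2m
...   | c , a+c≡2m = NonNeg-≡ (cong (_- + b) (trans (cong -_ (difference-ℤ a _ c a+c≡2m)) (ring (+ a) (+ (2 N.* m)))))
                       refl (√5-lower c b (subst (λ d → d N.* d N.≤ 5 N.* (b N.* b)) 2m∸a≡c sq≤))
  where
  ring : ∀ a m₂ → - (m₂ - a) ≡ a - m₂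
  ring = solve-∀
  2m∸a≡c : 2 N.* m N.∸ a ≡ c
  2m∸a≡c = trans (cong (N._∸ a) (sym a+c≡2m)) (NP.m+n∸m≡n a c)
FloorHalfSqrt5-lower a b m sq≤ | inj₂ 2m≤a with NP.m≤n⇒∃[o]m+o≡n 2m≤a
... | k , 2m+k≡a = NonNeg-sum (NonNeg-ℕ k) (NonNeg-√5 b)
  (trans (cong (λ z → z + (+ 0 - + b)) (difference-ℤ (2 N.* m) a k 2m+k≡a)) (ring (+ a) (+ (2 N.* m)) (+ b)))
  (ZP.+-identityˡ _)
  where
  ring : ∀ a m₂ b → a - m₂ + (+ 0 - b) ≡ a - m₂ - b
  ring = solve-∀

FloorHalfSqrt5-upper : ∀ a b m → a N.< 2 N.* (m N.+ 1) →
                       5 N.* (b N.* b) N.< (2 N.* (m N.+ 1) N.∸ a) N.* (2 N.* (m N.+ 1) N.∸ a) →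
                       Pos (+ (2 N.* (m N.+ 1)) - + a +√5 - (+ b))
FloorHalfSqrt5-upper a b m a< 5b²< with NP.m≤n⇒∃[o]m+o≡n (NP.<⇒≤ a<)
... | c , a+c≡ = Pos-≡ (cong (_- - (+ b)) (difference-ℤ a _ c a+c≡)) refl
  (√5-upper c b (subst (λ d → 5 N.* (b N.* b) N.< d N.* d) (trans (cong (N._∸ a) (sym a+c≡)) (NP.m+n∸m≡n a c)) 5b²<))

-- If a - b = 2r then (a + b√5)/2 = r + bφ, so m = ⌊(a + b√5)/2⌋ means
-- m - r = ⌊bφ⌋.
FloorHalfSqrt5→IsFloorφ : ∀ a b m r → + a - + b ≡ + 2 * r → FloorHalfSqrt5 a b m → IsFloorφ b (+ m - r)
FloorHalfSqrt5→IsFloorφ a b m r a-b≡2r (sq≤ , a< , 5b²<) =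
  NonNeg-half (- (+ m - r) , + b) (NonNeg-≡ lower₁ (ring₂ (+ b)) (FloorHalfSqrt5-lower a b m sq≤)) ,
  Pos-half (+ m - r + + 1 , - (+ b)) (Pos-≡ upper₁ (ring₄ (+ b)) (FloorHalfSqrt5-upper a b m a< 5b²<))
  where
  open ≡-Reasoning
  ring₁ : ∀ A B M₂ → A - M₂ - B ≡ (A - B) - M₂
  ring₁ = solve-∀
  ring₂ : ∀ b → + 2 * b ≡ b + b
  ring₂ = solve-∀
  ring₃ : ∀ M R → + 2 * R - + 2 * M ≡ - (M - R) + - (M - R)
  ring₃ = solve-∀
  ring₄ : ∀ b → + 2 * - b ≡ - b + - b
  ring₄ = solve-∀
  ring₅ : ∀ A B M₂ → M₂ - A - - B ≡ M₂ - (A - B)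
  ring₅ = solve-∀
  ring₆ : ∀ M R → + 2 * (M + + 1) - + 2 * R ≡ M - R + + 1 + (M - R + + 1)
  ring₆ = solve-∀
  lower₁ : + a - + (2 N.* m) - + b ≡ - (+ m - r) + - (+ m - r)
  lower₁ = begin
    + a - + (2 N.* m) - + b  ≡⟨ ring₁ (+ a) (+ b) (+ (2 N.* m)) ⟩
    (+ a - + b) - + (2 N.* m) ≡⟨ cong₂ _-_ a-b≡2r (ZP.pos-* 2 m) ⟩
    + 2 * r - + 2 * + m      ≡⟨ ring₃ (+ m) r ⟩
    - (+ m - r) + - (+ m - r) ∎
  upper₁ : + (2 N.* (m N.+ 1)) - + a - - (+ b) ≡ + m - r + + 1 + (+ m - r + + 1)
  upper₁ = begin
    + (2 N.* (m N.+ 1)) - + a - - (+ b) ≡⟨ ring₅ (+ a) (+ b) (+ (2 N.* (m N.+ 1))) ⟩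
    + (2 N.* (m N.+ 1)) - (+ a - + b)   ≡⟨ cong₂ _-_ (trans (ZP.pos-* 2 (m N.+ 1)) (cong (+ 2 *_) (ZP.pos-+ m 1))) a-b≡2r ⟩
    + 2 * (+ m + + 1) - + 2 * r         ≡⟨ ring₆ (+ m) r ⟩
    + m - r + + 1 + (+ m - r + + 1)     ∎

FloorNPhi→IsFloorφ : ∀ n m → FloorNPhi n m → IsFloorφ n (+ m)
FloorNPhi→IsFloorφ n m fl = subst (IsFloorφ n) (ZP.+-identityʳ (+ m))
  (FloorHalfSqrt5→IsFloorφ n n m (+ 0) (ZP.+-inverseʳ (+ n)) fl)

FloorNPhi2→floorφ² : ∀ n m → FloorNPhi2 n m → m ≡ floorφ² n
FloorNPhi2→floorφ² n m fl = ZP.+-injective (begin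
  + m                        ≡⟨ ring (+ m) (+ n) ⟩
  + m - + n + + n            ≡⟨ cong (_+ + n) (IsFloorφ-unique n _ _ (FloorHalfSqrt5→IsFloorφ (3 N.* n) n m (+ n) 3n-n≡2n fl) (floorφ-spec n)) ⟩
  + floorφ n + + n           ∎)
  where
  open ≡-Reasoning
  ring : ∀ m n → m ≡ m - n + n
  ring = solve-∀
  ring′ : ∀ n → + 3 * n - n ≡ + 2 * n
  ring′ = solve-∀
  3n-n≡2n : + (3 N.* n) - + n ≡ + 2 * + n
  3n-n≡2n = trans (cong (_- + n) (ZP.pos-* 3 n)) (ring′ (+ n))

-- For n ≥ 1 and m = ⌊nφ⌋: ⌊mφ⌋ = m + n - 1 and ⌊(m+1)φ⌋ = m + n + 1.
-- Multiplying m < nφ < m + 1 by φ - 1 = 1/φ gives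
-- (m+1)φ - (m+1+n) > 0 and (m+n) - mφ > 0; with 1 < φ < 2 this suffices.
floorφ-at-floorφ : ∀ n m → 1 N.≤ n → IsFloorφ n (+ m) →
                   IsFloorφ m (+ m + + n - + 1) × IsFloorφ (suc m) (+ m + + n + + 1)
floorφ-at-floorφ n m 1≤n fl =
  (inj₁ (Pos-sum above Pos-2-φ (ring₁ M N) (ring₂ M N)) , Pos-≡ (ring₃ M N) (ring₄ M N) below) ,
  (inj₁ (Pos-≡ (ring₅ M N) (ring₆ M N) above) , Pos-sum below Pos-2-φ (ring₇ M N) (ring₈ M N))
  where
  M N : ℤ
  M = + m
  N = + n
  below : Pos ((- M , N) ⊗ (- (+ 1) , + 1))
  below = Pos-⊗ _ _ (IsFloorφ-strict n (+ m) 1≤n fl) Pos-φ-1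
  above : Pos ((M + + 1 , - N) ⊗ (- (+ 1) , + 1))
  above = Pos-⊗ _ _ (proj₂ fl) Pos-φ-1
  ring₁ : ∀ M N → (M + + 1) * - (+ 1) + - N * + 1 + + 2 ≡ - (M + N - + 1)
  ring₁ = solve-∀
  ring₂ : ∀ M N → (M + + 1) * + 1 + - N * - (+ 1) + - N * + 1 + - (+ 1) ≡ M
  ring₂ = solve-∀
  ring₃ : ∀ M N → - M * - (+ 1) + N * + 1 ≡ M + N - + 1 + + 1
  ring₃ = solve-∀
  ring₄ : ∀ M N → - M * + 1 + N * - (+ 1) + N * + 1 ≡ - M
  ring₄ = solve-∀
  ring₅ : ∀ M N → (M + + 1) * - (+ 1) + - N * + 1 ≡ - (M + N + + 1)
  ring₅ = solve-∀
  ring₆ : ∀ M N → (M + + 1) * + 1 + - N * - (+ 1) + - N * + 1 ≡ + 1 + M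
  ring₆ = solve-∀
  ring₇ : ∀ M N → - M * - (+ 1) + N * + 1 + + 2 ≡ M + N + + 1 + + 1
  ring₇ = solve-∀
  ring₈ : ∀ M N → - M * + 1 + N * - (+ 1) + N * + 1 + - (+ 1) ≡ - (+ 1 + M)
  ring₈ = solve-∀

AB+1-position : ∀ n m → 1 N.≤ n → FloorNPhi n m →
                2 N.* m N.+ n N.+ 1 ≡ floorφ² m N.+ 2 × floorφ² (suc m) ≡ floorφ² m N.+ 3
AB+1-position n m 1≤n fl = ZP.+-injective (sym shift-2) , ZP.+-injective gap-3
  where
  open ≡-Reasoning
  floors : IsFloorφ m (+ m + + n - + 1) × IsFloorφ (suc m) (+ m + + n + + 1)
  floors = floorφ-at-floorφ n m 1≤n (FloorNPhi→IsFloorφ n m fl)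
  at-m : + floorφ m ≡ + m + + n - + 1
  at-m = IsFloorφ-unique m _ _ (floorφ-spec m) (proj₁ floors)
  at-m+1 : + floorφ (suc m) ≡ + m + + n + + 1
  at-m+1 = IsFloorφ-unique (suc m) _ _ (floorφ-spec (suc m)) (proj₂ floors)
  ring₁ : ∀ m n → m + n - + 1 + m + + 2 ≡ + 2 * m + n + + 1
  ring₁ = solve-∀
  ring₂ : ∀ m n → m + n + + 1 + (+ 1 + m) ≡ m + n - + 1 + m + + 3
  ring₂ = solve-∀
  shift-2 : + floorφ m + + m + + 2 ≡ + (2 N.* m) + + n + + 1
  shift-2 = begin
    + floorφ m + + m + + 2          ≡⟨ cong (λ a → a + + m + + 2) at-m ⟩
    + m + + n - + 1 + + m + + 2     ≡⟨ ring₁ (+ m) (+ n) ⟩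
    + 2 * + m + + n + + 1           ≡⟨ cong (λ d → d + + n + + 1) (ZP.pos-* 2 m) ⟨
    + (2 N.* m) + + n + + 1         ∎
  gap-3 : + floorφ (suc m) + (+ 1 + + m) ≡ + floorφ m + + m + + 3
  gap-3 = begin
    + floorφ (suc m) + (+ 1 + + m)  ≡⟨ cong (λ a → a + (+ 1 + + m)) at-m+1 ⟩
    + m + + n + + 1 + (+ 1 + + m)   ≡⟨ ring₂ (+ m) (+ n) ⟩
    + m + + n - + 1 + + m + + 3     ≡⟨ cong (λ a → a + + m + + 3) at-m ⟨
    + floorφ m + + m + + 3          ∎

mainTheorem2 : (g : ℕ → ℕ) → IsSGFunction InS g →
    (∀ x → (InB x → g x ≡ 0) × (InB+1 x → g x ≡ 1) × (InAB+1 x → g x ≡ 2))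
mainTheorem2 g isSG x = in-B , in-B+1 , in-AB+1
  where
  value : ∀ n c → x ≡ floorφ² n N.+ c → floorφ² n N.+ c N.< floorφ² (suc n) → g x ≡ c
  value n c x≡ below = grundy-offset g isSG x (offset n c x≡ (subst (N._< floorφ² (suc n)) (sym x≡) below))

  in-B : InB x → g x ≡ 0
  in-B (n , _ , m , fl , x≡m) =
    value n 0 (trans x≡m (trans (FloorNPhi2→floorφ² n m fl) (sym (NP.+-identityʳ (floorφ² n)))))
      (small-shift-below n 0 N.z≤n)

  in-B+1 : InB+1 x → g x ≡ 1
  in-B+1 (n , m , fl , x≡m+1) =
    value n 1 (trans x≡m+1 (cong (N._+ 1) (FloorNPhi2→floorφ² n m fl))) (small-shift-below n 1 NP.≤-refl)

  in-AB+1 : InAB+1 x → g x ≡ 2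
  in-AB+1 (n , 1≤n , m , fl , x≡) =
    value m 2 (trans x≡ (proj₁ position))
      (subst (floorφ² m N.+ 2 N.<_) (sym (proj₂ position)) (NP.+-monoʳ-< (floorφ² m) NP.≤-refl))
    where
    position : 2 N.* m N.+ n N.+ 1 ≡ floorφ² m N.+ 2 × floorφ² (suc m) ≡ floorφ² m N.+ 3
    position = AB+1-position n m 1≤n fl
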